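{- Let $k\ge 2$. For every $n\ge 0$, \[ \frac{R_{n+1}^{(k\le\max,\emptyset,0,0)}(x)}{n!}=\sum_{i=1}^{n+1}\frac{R_{i-1}^{(k-1,\emptyset,0,0)}(x)}{(i-1)!}, \] and consequently \[ R^{(k\le\max,\emptyset,0,0)}(t,x)=1+\int_0^t\frac{1}{1-z}R^{(k-1,\emptyset,0,0)}(z,x)\,dz. \]
   Context: For $\sigma=\sigma_1\cdots\sigma_n\in S_n$ and $m\ge1$: $\sigma_i$ matches $MMP(m,\emptyset,0,0)$ if there are at least $m$ indices $j>i$ with $\sigma_j>\sigma_i$ and no index $j<i$ with $\sigma_j>\sigma_i$. $\sigma_i$ matches $MMP(k\le\max,\emptyset,0,0)$ if no $j<i$ has $\sigma_j>\sigma_i$, and, with $\sigma_m=\max\{\sigma_{i+1},\dots,\sigma_n\}$ ($i<n$), at least $k$ of $\sigma_{i+1},\dots,\sigma_m$ are greater than $\sigma_i$ (equivalently: at least $k-1$ points of quadrant I lie to the left of the largest point of quadrant I, where quadrant I is the set of $(j,\sigma_j)$ with $j>i,\sigma_j>\sigma_i$). For a pattern $P$, $mmp^{P}(\sigma)$ is the number of $i$ such that $\sigma_i$ matches $P$, $R_n^{P}(x)=\sum_{\sigma\in S_n}x^{mmp^P(\sigma)}$, $R_0^P(x)=1$, and $R^P(t,x)=1+\sum_{n\ge1}R_n^P(x)t^n/n!$. -}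

module Defs where

open import Data.Bool using (Bool; true; false; _∧_; if_then_else_)
open import Data.Nat using (ℕ; zero; suc; _+_; _*_; _∸_; _≤ᵇ_; _<ᵇ_; _⊔_; _≟_; _/_)
open import Data.Nat.Properties using (_!≢0)
open import Data.Nat.Base using (_!)
open import Data.Fin using (Fin; toℕ)
open import Data.Fin.Properties as FinP using ()
open import Data.List using (List; []; _∷_; _++_; [_]; map; concatMap; filter; filterᵇ; length; allFin; sum; upTo)
open import Data.Vec using (Vec; toList) renaming ([] to []ᵥ; _∷_ to _∷ᵥ_)
import Data.List.Relation.Unary.Unique.DecPropositional as UDec
open import Relation.Nullary.Decidable using (⌊_⌋)

-- A permutation σ = σ₁⋯σₙ ∈ Sₙ is represented by its one-line notation as a
-- list of naturals; the values are 0,…,n-1 (only their relative order matters).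

words : (n m : ℕ) → List (Vec (Fin n) m)
words n zero    = []ᵥ ∷ []
words n (suc m) = concatMap (λ a → map (a ∷ᵥ_) (words n m)) (allFin n)

perms : ℕ → List (List ℕ)
perms n = map (λ w → map toℕ (toList w))
              (filter (λ w → UDec.unique? (FinP._≟_ {n}) (toList w)) (words n n))

#greater : ℕ → List ℕ → ℕ
#greater x ys = length (filterᵇ (x <ᵇ_) ys)

noneGreater : ℕ → List ℕ → Bool
noneGreater x []        = true
noneGreater x (y ∷ ys)  = (y ≤ᵇ x) ∧ noneGreater x ys

-- A position pattern: a Boolean test on (prefix σ₁…σ_{i-1}, σᵢ, suffix σ_{i+1}…σₙ).
Pattern : Set
Pattern = List ℕ → ℕ → List ℕ → Bool

MMP : ℕ → Pattern
MMP m pre x suf = noneGreater x pre ∧ (m ≤ᵇ #greater x suf)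

maxL : List ℕ → ℕ
maxL []       = 0
maxL (y ∷ ys) = y ⊔ maxL ys

upToValue : ℕ → List ℕ → List ℕ
upToValue v []       = []
upToValue v (y ∷ ys) = if (y ≤ᵇ v) ∧ (v ≤ᵇ y) then y ∷ [] else y ∷ upToValue v ys

-- MMP(k≤max,∅,0,0): no earlier larger entry, i < n, and with σ_m the maximum of
-- σ_{i+1},…,σ_n, at least k of σ_{i+1},…,σ_m are greater than σᵢ
MMPmax : ℕ → Pattern
MMPmax k pre x []        = false
MMPmax k pre x (y ∷ ys)  =
  noneGreater x pre ∧ (k ≤ᵇ #greater x (upToValue (maxL (y ∷ ys)) (y ∷ ys)))

mmpGo : Pattern → List ℕ → List ℕ → ℕ
mmpGo P pre []       = 0
mmpGo P pre (x ∷ xs) = (if P pre x xs then 1 else 0) + mmpGo P (pre ++ [ x ]) xs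

mmp : Pattern → List ℕ → ℕ
mmp P σ = mmpGo P [] σ

-- coeff P n j = coefficient of x^j in R_n^P(x) = #{σ ∈ Sₙ : mmp^P(σ) = j}
coeff : Pattern → ℕ → ℕ → ℕ
coeff P n j = length (filter (λ σ → mmp P σ ≟ j) (perms n))

-- n! / i!   (exact when i ≤ n)
fallingRatio : ℕ → ℕ → ℕ
fallingRatio n i = (n !) / (i !)
  where instance _ = i !≢0

-- Split a permutation of {0,…,n} around its maximum as α n β with |α| = i.  Neither n nor an entry
-- of β can match MMP(k≤max): nothing after n is larger than n, and every entry of β has n before
-- it.  For a left-to-right maximum x in α, the largest later entry is n, so the entries counted
-- for x are those after x in α together with n itself; hence x matches MMP(k≤max) exactly when it
-- matches MMP(k-1) inside α, and the statistic of α n β is mmp^(k-1)(α).  Listing S_(N+1) as a permutation τ ∈ S_N shifted past a new last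
-- value a ∈ {0,…,N} leaves the relative order of every prefix of length i ≤ N unchanged, so each
-- prefix count is multiplied by N+1; as mmp^(k-1) only sees relative order, the length-i prefixes
-- of S_n contribute n!/i! copies of the distribution of mmp^(k-1) over S_i.

module Submission where

open import Defs
open import Data.Bool using (true; false; _∧_; not; if_then_else_)
open import Data.Bool.Properties using (∧-zeroʳ)
open import Data.Empty using (⊥; ⊥-elim)
open import Data.Fin using (Fin; toℕ; fromℕ<)
import Data.Fin.Properties as Fin
open import Data.List
  using (List; []; _∷_; _++_; [_]; _∷ʳ_; map; filter; length; upTo; allFin; take; drop; concatMap;
         cartesianProductWith; initLast; _∷ʳ′_)
open import Data.List.Properties
  using (∷-injective; ∷-injectiveˡ; ∷-injectiveʳ; ∷ʳ-injective; map-injective; map-cong-local; length-map;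
         length-++; length-++-sucʳ; length-++-≤ˡ; length-take; length-upTo; ++-identityʳ; filter-++; map-++;
         take-all; take++drop≡id)
open import Data.List.Membership.Propositional using (_∈_; _∉_)
open import Data.List.Membership.Propositional.Properties
  using (∈-map⁺; ∈-map⁻; ∈-++⁺ˡ; ∈-++⁺ʳ; ∈-upTo⁺; ∈-upTo⁻; ∈-∃++; ∈-filter⁺; ∈-filter⁻;
         ∈-allFin; ∈-cartesianProductWith⁺; ∈-cartesianProductWith⁻)
open import Data.List.Membership.Propositional.Properties.WithK using (unique∧set⇒bag)
open import Data.List.Relation.Binary.BagAndSetEquality using (∼bag⇒↭)
open import Data.List.Relation.Binary.Permutation.Propositional using (_↭_; ↭-sym; ↭⇒↭ₛ)
open import Data.List.Relation.Binary.Permutation.Propositional.Properties using (shift; ↭-length; filter-↭)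
import Data.List.Relation.Binary.Permutation.Setoid.Properties as Permutationₛ
open import Data.List.Relation.Unary.All as All using (All; []; _∷_)
import Data.List.Relation.Unary.All.Properties as All
open import Data.List.Relation.Unary.AllPairs using ([]; _∷_)
open import Data.List.Relation.Unary.Any using (here; there)
open import Data.List.Relation.Unary.Unique.Propositional using (Unique)
import Data.List.Relation.Unary.Unique.Propositional.Properties as Unique
import Data.List.Relation.Unary.Unique.DecPropositional as UniqueDec
open import Data.Nat
  using (ℕ; zero; suc; pred; _+_; _*_; _∸_; _≤_; _<_; _≤′_; ≤′-refl; ≤′-step; _≤ᵇ_; _<ᵇ_; _⊔_;
         _≟_; _!; z≤n; s≤s)
open import Data.Nat.Properties
  using (≤-refl; ≤-reflexive; ≤-pred; <⇒≤; <-irrefl; ≤∧≢⇒<; m<n⇒m<1+n; n<1+n; suc-injective;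
         +-comm; *-identityˡ; *-assoc; ⊔-lub; m≤n⇒m⊔n≡n; m≥n⇒m⊔n≡m; m≤n⇒m⊓n≡m; m≤n⇒m<n∨m≡n;
         ≤⇒≤′; ≤′⇒≤; _!≢0)
open import Data.Nat.DivMod using (*-/-assoc; n/n≡1)
open import Data.Nat.Divisibility using (m≤n⇒m!∣n!)
open import Data.Nat.ListAction using (sum)
open import Data.Product using (Σ; _×_; _,_; proj₁; proj₂)
open import Data.Sum using (inj₁; inj₂)
open import Data.Vec using (Vec; toList) renaming ([] to []ᵥ; _∷_ to _∷ᵥ_)
import Data.Vec.Properties as Vec
open import Function using (_∘_; mk⇔)
open import Relation.Nullary using (does)
open import Relation.Binary.PropositionalEquality
  using (_≡_; _≢_; refl; sym; trans; cong; cong₂; subst; setoid; module ≡-Reasoning)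
open ≡-Reasoning

Unique-++-∷⁻ : ∀ {A : Set} {x : A} α β → Unique (α ++ x ∷ β) → x ∉ α ++ β × Unique (α ++ β)
Unique-++-∷⁻ {A} {x} α β u with Permutationₛ.Unique-resp-↭ (setoid A) (↭⇒↭ₛ (shift x α β)) u
... | x∉ ∷ u′ = All.All¬⇒¬Any x∉ , u′

Unique-++-∷⁺ : ∀ {A : Set} {x : A} α β → x ∉ α ++ β → Unique (α ++ β) → Unique (α ++ x ∷ β)
Unique-++-∷⁺ {A} {x} α β x∉ u =
  Permutationₛ.Unique-resp-↭ (setoid A) (↭⇒↭ₛ (↭-sym (shift x α β)))
    (All.¬Any⇒All¬ (α ++ β) x∉ ∷ u)

Unique-∷ʳ⁻ : ∀ {A : Set} {x : A} xs → Unique (xs ∷ʳ x) → x ∉ xs × Unique xs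
Unique-∷ʳ⁻ {x = x} xs u with Unique-++-∷⁻ xs [] u
... | x∉ , u′ = subst (x ∉_) (++-identityʳ xs) x∉ , subst Unique (++-identityʳ xs) u′

map-unique : ∀ {A B : Set} {f : A → B} {xs} →
  (∀ {x y} → x ∈ xs → y ∈ xs → f x ≡ f y → x ≡ y) → Unique xs → Unique (map f xs)
map-unique {xs = []} _ [] = []
map-unique {xs = x ∷ xs} inj (x∉ ∷ u) =
  All.map⁺ (All.tabulate λ y∈ fx≡fy → All.lookup x∉ y∈ (inj (here refl) (there y∈) fx≡fy))
  ∷ map-unique (λ x∈ y∈ → inj (there x∈) (there y∈)) u

cartesianProductWith-unique : ∀ {A B C : Set} (f : A → B → C) {xs ys} →
  (∀ {a a′ b b′} → a ∈ xs → a′ ∈ xs → b ∈ ys → b′ ∈ ys → f a b ≡ f a′ b′ → a ≡ a′ × b ≡ b′) →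
  Unique xs → Unique ys → Unique (cartesianProductWith f xs ys)
cartesianProductWith-unique f {[]} _ [] _ = []
cartesianProductWith-unique f {a ∷ xs} {ys} inj (a∉ ∷ uxs) uys =
  Unique.++⁺ (map-unique (λ b∈ b′∈ → proj₂ ∘ inj (here refl) (here refl) b∈ b′∈) uys)
             (cartesianProductWith-unique f (λ a∈ a′∈ → inj (there a∈) (there a′∈)) uxs uys)
             disjoint
  where
  disjoint : ∀ {v} → v ∈ map (f a) ys × v ∈ cartesianProductWith f xs ys → ⊥
  disjoint (v∈map , v∈prod) with ∈-map⁻ (f a) v∈map | ∈-cartesianProductWith⁻ f xs ys v∈prod
  ... | b , b∈ , refl | a′ , b′ , a′∈ , b′∈ , eq =
    All.lookup a∉ a′∈ (proj₁ (inj (here refl) (there a′∈) b∈ b′∈ eq))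

concatMap≡cartesianProductWith : ∀ {A B C : Set} (f : A → B → C) xs ys →
  concatMap (λ x → map (f x) ys) xs ≡ cartesianProductWith f xs ys
concatMap≡cartesianProductWith f []       ys = refl
concatMap≡cartesianProductWith f (x ∷ xs) ys = cong (map (f x) ys ++_) (concatMap≡cartesianProductWith f xs ys)

++-∷-injective : ∀ {A : Set} {x : A} {α α′ β β′} → x ∉ α → x ∉ α′ →
  α ++ x ∷ β ≡ α′ ++ x ∷ β′ → α ≡ α′ × β ≡ β′
++-∷-injective {α = []}    {[]}     _   _    eq = refl , proj₂ (∷-injective eq)
++-∷-injective {α = []}    {a ∷ α′} _   x∉α′ eq = ⊥-elim (x∉α′ (here (proj₁ (∷-injective eq))))
++-∷-injective {α = a ∷ α} {[]}     x∉α _    eq = ⊥-elim (x∉α (here (sym (proj₁ (∷-injective eq)))))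
++-∷-injective {α = a ∷ α} {a′ ∷ α′} x∉α x∉α′ eq with ∷-injective eq
... | refl , eq′ with ++-∷-injective (x∉α ∘ there) (x∉α′ ∘ there) eq′
...   | refl , β≡β′ = refl , β≡β′

length-∷ʳ : ∀ {A : Set} (xs : List A) x → length (xs ∷ʳ x) ≡ suc (length xs)
length-∷ʳ xs x = trans (length-++ xs) (+-comm (length xs) 1)

length-take-≤ : ∀ {A : Set} {i} (xs : List A) → i ≤ length xs → length (take i xs) ≡ i
length-take-≤ {i = i} xs i≤ = trans (length-take i xs) (m≤n⇒m⊓n≡m i≤)

take-length-++ : ∀ {A : Set} (α β : List A) → take (length α) (α ++ β) ≡ α
take-length-++ []      β = refl
take-length-++ (a ∷ α) β = cong (a ∷_) (take-length-++ α β)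

drop-length-++ : ∀ {A : Set} (α β : List A) → drop (length α) (α ++ β) ≡ β
drop-length-++ []      β = refl
drop-length-++ (a ∷ α) β = drop-length-++ α β

sum-map-cong : ∀ {A : Set} {f g : A → ℕ} xs → (∀ {x} → x ∈ xs → f x ≡ g x) →
  sum (map f xs) ≡ sum (map g xs)
sum-map-cong _ f≡g = cong sum (map-cong-local (All.tabulate f≡g))

sum-map-const : ∀ {A : Set} c (xs : List A) → sum (map (λ _ → c) xs) ≡ length xs * c
sum-map-const c []       = refl
sum-map-const c (x ∷ xs) = cong (c +_) (sum-map-const c xs)

count : ∀ {A : Set} → (A → ℕ) → ℕ → List A → ℕ
count f j xs = length (filter (λ x → f x ≟ j) xs)

δ : ℕ → ℕ → ℕ
δ m n = if does (m ≟ n) then 1 else 0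

module _ {j : ℕ} where

  count-∷ : ∀ {A : Set} {f : A → ℕ} x xs → count f j (x ∷ xs) ≡ δ (f x) j + count f j xs
  count-∷ {f = f} x xs with does (f x ≟ j)
  ... | true  = refl
  ... | false = refl

  count-++ : ∀ {A : Set} {f : A → ℕ} xs ys → count f j (xs ++ ys) ≡ count f j xs + count f j ys
  count-++ {f = f} xs ys = begin
    length (filter _ (xs ++ ys))         ≡⟨ cong length (filter-++ (λ x → f x ≟ j) xs ys) ⟩
    length (filter _ xs ++ filter _ ys)  ≡⟨ length-++ (filter (λ x → f x ≟ j) xs) ⟩
    count f j xs + count f j ys          ∎

  count-↭ : ∀ {A : Set} {f : A → ℕ} {xs ys} → xs ↭ ys → count f j xs ≡ count f j ys
  count-↭ {f = f} p = ↭-length (filter-↭ (λ x → f x ≟ j) p)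

  count-cong : ∀ {A : Set} {f g : A → ℕ} {xs} → (∀ {x} → x ∈ xs → f x ≡ g x) →
    count f j xs ≡ count g j xs
  count-cong {xs = []} _ = refl
  count-cong {f = f} {g} {x ∷ xs} f≡g = begin
    count f j (x ∷ xs)        ≡⟨ count-∷ x xs ⟩
    δ (f x) j + count f j xs  ≡⟨ cong₂ (λ v c → δ v j + c) (f≡g (here refl))
                                        (count-cong (f≡g ∘ there)) ⟩
    δ (g x) j + count g j xs  ≡⟨ count-∷ x xs ⟨
    count g j (x ∷ xs)        ∎

  count-map : ∀ {A B : Set} {f : A → ℕ} (g : B → A) xs → count f j (map g xs) ≡ count (f ∘ g) j xs
  count-map g [] = refl
  count-map {f = f} g (x ∷ xs) = begin
    count f j (g x ∷ map g xs)          ≡⟨ count-∷ (g x) (map g xs) ⟩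
    δ (f (g x)) j + count f j (map g xs) ≡⟨ cong (δ (f (g x)) j +_) (count-map g xs) ⟩
    δ (f (g x)) j + count (f ∘ g) j xs  ≡⟨ count-∷ x xs ⟨
    count (f ∘ g) j (x ∷ xs)            ∎

  count-cartesianProductWith : ∀ {A B C : Set} {f : A → ℕ} (g : B → C → A) xs ys →
    count f j (cartesianProductWith g xs ys) ≡ sum (map (λ x → count (f ∘ g x) j ys) xs)
  count-cartesianProductWith g [] ys = refl
  count-cartesianProductWith {f = f} g (x ∷ xs) ys = begin
    count f j (map (g x) ys ++ cartesianProductWith g xs ys)
      ≡⟨ count-++ (map (g x) ys) _ ⟩
    count f j (map (g x) ys) + count f j (cartesianProductWith g xs ys)
      ≡⟨ cong₂ _+_ (count-map (g x) ys) (count-cartesianProductWith g xs ys) ⟩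
    count (f ∘ g x) j ys + sum (map (λ x → count (f ∘ g x) j ys) xs)  ∎

≤ᵇ≡not-<ᵇ : ∀ m n → (m ≤ᵇ n) ≡ not (n <ᵇ m)
≤ᵇ≡not-<ᵇ zero          n       = refl
≤ᵇ≡not-<ᵇ (suc m)       zero    = refl
≤ᵇ≡not-<ᵇ (suc zero)    (suc n) = refl
≤ᵇ≡not-<ᵇ (suc (suc m)) (suc n) = ≤ᵇ≡not-<ᵇ (suc m) n

suc-≤ᵇ-suc : ∀ m n → (suc m ≤ᵇ suc n) ≡ (m ≤ᵇ n)
suc-≤ᵇ-suc zero    n = refl
suc-≤ᵇ-suc (suc m) n = refl

<ᵇ≡true : ∀ {m n} → m < n → (m <ᵇ n) ≡ true
<ᵇ≡true (s≤s z≤n)       = refl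
<ᵇ≡true (s≤s (s≤s m≤n)) = <ᵇ≡true (s≤s m≤n)

<ᵇ≡false : ∀ {m n} → n ≤ m → (m <ᵇ n) ≡ false
<ᵇ≡false z≤n       = refl
<ᵇ≡false (s≤s n≤m) = <ᵇ≡false n≤m

≤ᵇ≡true : ∀ {m n} → m ≤ n → (m ≤ᵇ n) ≡ true
≤ᵇ≡true z≤n = refl
≤ᵇ≡true (s≤s m≤n) = <ᵇ≡true (s≤s m≤n)

≤ᵇ≡false : ∀ {m n} → n < m → (m ≤ᵇ n) ≡ false
≤ᵇ≡false (s≤s n≤m) = <ᵇ≡false n≤m

-- MMP only sees relative order

OrderEmbedding : (ℕ → ℕ) → Set
OrderEmbedding f = ∀ x y → (f x <ᵇ f y) ≡ (x <ᵇ y)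

OrderInvariant : (List ℕ → ℕ) → Set
OrderInvariant g = ∀ f → OrderEmbedding f → ∀ σ → g (map f σ) ≡ g σ

module _ {f : ℕ → ℕ} (f-emb : OrderEmbedding f) where

  #greater-map : ∀ x ys → #greater (f x) (map f ys) ≡ #greater x ys
  #greater-map x [] = refl
  #greater-map x (y ∷ ys) rewrite f-emb x y with x <ᵇ y
  ... | true  = cong suc (#greater-map x ys)
  ... | false = #greater-map x ys

  noneGreater-map : ∀ x ys → noneGreater (f x) (map f ys) ≡ noneGreater x ys
  noneGreater-map x [] = refl
  noneGreater-map x (y ∷ ys) = cong₂ _∧_ ≤ᵇ-preserved (noneGreater-map x ys)
    where
    ≤ᵇ-preserved : (f y ≤ᵇ f x) ≡ (y ≤ᵇ x)
    ≤ᵇ-preserved = begin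
      f y ≤ᵇ f x        ≡⟨ ≤ᵇ≡not-<ᵇ (f y) (f x) ⟩
      not (f x <ᵇ f y)  ≡⟨ cong not (f-emb x y) ⟩
      not (x <ᵇ y)      ≡⟨ ≤ᵇ≡not-<ᵇ y x ⟨
      y ≤ᵇ x            ∎

  mmpGo-MMP-map : ∀ m pre xs → mmpGo (MMP m) (map f pre) (map f xs) ≡ mmpGo (MMP m) pre xs
  mmpGo-MMP-map m pre [] = refl
  mmpGo-MMP-map m pre (x ∷ xs) =
    cong₂ (λ b c → (if b then 1 else 0) + c)
      (cong₂ (λ b c → b ∧ (m ≤ᵇ c)) (noneGreater-map x pre) (#greater-map x xs))
      (trans (cong (λ p → mmpGo (MMP m) p (map f xs)) (sym (map-++ f pre [ x ])))
             (mmpGo-MMP-map m (pre ∷ʳ x) xs))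

mmp-MMP-orderInvariant : ∀ m → OrderInvariant (mmp (MMP m))
mmp-MMP-orderInvariant m f f-emb = mmpGo-MMP-map f-emb m []

-- MMPmax around the maximum

maxL≤ : ∀ {n} ys → All (_≤ n) ys → maxL ys ≤ n
maxL≤ []       []         = z≤n
maxL≤ (y ∷ ys) (y≤ ∷ ys≤) = ⊔-lub y≤ (maxL≤ ys ys≤)

maxL-++-∷ : ∀ {n} α β → All (_< n) α → All (_< n) β → maxL (α ++ n ∷ β) ≡ n
maxL-++-∷ []      β _          β< = m≥n⇒m⊔n≡m (maxL≤ β (All.map <⇒≤ β<))
maxL-++-∷ (a ∷ α) β (a< ∷ α<) β< =
  trans (cong (a ⊔_) (maxL-++-∷ α β α< β<)) (m≤n⇒m⊔n≡n (<⇒≤ a<))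

upToValue-++-∷ : ∀ {n} α β → All (_< n) α → upToValue n (α ++ n ∷ β) ≡ α ∷ʳ n
upToValue-++-∷ {n} [] β _ rewrite ≤ᵇ≡true (≤-refl {n}) = refl
upToValue-++-∷ {n} (a ∷ α) β (a< ∷ α<) rewrite ≤ᵇ≡false a< | ∧-zeroʳ (a ≤ᵇ n) =
  cong (a ∷_) (upToValue-++-∷ α β α<)

#greater-∷ʳ : ∀ {x n} ys → x < n → #greater x (ys ∷ʳ n) ≡ suc (#greater x ys)
#greater-∷ʳ []       x<n rewrite <ᵇ≡true x<n = refl
#greater-∷ʳ {x} (y ∷ ys) x<n with x <ᵇ y
... | true  = cong suc (#greater-∷ʳ ys x<n)
... | false = #greater-∷ʳ ys x<n

#greater≡0 : ∀ {x} zs → All (_≤ x) zs → #greater x zs ≡ 0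
#greater≡0 []       []         = refl
#greater≡0 (z ∷ zs) (z≤ ∷ zs≤) rewrite <ᵇ≡false z≤ = #greater≡0 zs zs≤

noneGreater≡false : ∀ {n y} pre → n ∈ pre → y < n → noneGreater y pre ≡ false
noneGreater≡false (z ∷ zs) (here refl) y<n rewrite ≤ᵇ≡false y<n = refl
noneGreater≡false {y = y} (z ∷ zs) (there n∈) y<n
  rewrite noneGreater≡false zs n∈ y<n = ∧-zeroʳ (z ≤ᵇ y)

upToValue-All : ∀ {P : ℕ → Set} v ys → All P ys → All P (upToValue v ys)
upToValue-All v []       []         = []
upToValue-All v (y ∷ ys) (py ∷ pys) with (y ≤ᵇ v) ∧ (v ≤ᵇ y)
... | true  = py ∷ []
... | false = py ∷ upToValue-All v ys pys

MMPmax≡false : ∀ k pre x xs → noneGreater x pre ≡ false → MMPmax k pre x xs ≡ false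
MMPmax≡false k pre x []       _  = refl
MMPmax≡false k pre x (y ∷ ys) ng rewrite ng = refl

MMPmax-at-max : ∀ k pre {n} β → All (_< n) β → MMPmax (suc k) pre n β ≡ false
MMPmax-at-max k pre []       _ = refl
MMPmax-at-max k pre {n} (y ∷ ys) β<
  rewrite #greater≡0 (upToValue (maxL (y ∷ ys)) (y ∷ ys)) (upToValue-All _ (y ∷ ys) (All.map <⇒≤ β<))
  = ∧-zeroʳ (noneGreater n pre)

MMPmax-++-∷ : ∀ k pre x α n β →
  MMPmax k pre x (α ++ n ∷ β)
    ≡ noneGreater x pre ∧ (k ≤ᵇ #greater x (upToValue (maxL (α ++ n ∷ β)) (α ++ n ∷ β)))
MMPmax-++-∷ k pre x []      n β = refl
MMPmax-++-∷ k pre x (a ∷ α) n β = refl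

MMPmax-before-max : ∀ k pre {n x} α β → All (_< n) α → All (_< n) β → x < n →
  MMPmax (suc k) pre x (α ++ n ∷ β) ≡ MMP k pre x α
MMPmax-before-max k pre {n} {x} α β α< β< x<n =
  trans (MMPmax-++-∷ (suc k) pre x α n β) (cong (noneGreater x pre ∧_) threshold)
  where
  threshold : (suc k ≤ᵇ #greater x (upToValue (maxL (α ++ n ∷ β)) (α ++ n ∷ β)))
              ≡ (k ≤ᵇ #greater x α)
  threshold = begin
    suc k ≤ᵇ #greater x (upToValue (maxL (α ++ n ∷ β)) (α ++ n ∷ β))
      ≡⟨ cong (λ v → suc k ≤ᵇ #greater x (upToValue v (α ++ n ∷ β))) (maxL-++-∷ α β α< β<) ⟩
    suc k ≤ᵇ #greater x (upToValue n (α ++ n ∷ β))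
      ≡⟨ cong (λ ys → suc k ≤ᵇ #greater x ys) (upToValue-++-∷ α β α<) ⟩
    suc k ≤ᵇ #greater x (α ∷ʳ n)
      ≡⟨ cong (suc k ≤ᵇ_) (#greater-∷ʳ α x<n) ⟩
    suc k ≤ᵇ suc (#greater x α)
      ≡⟨ suc-≤ᵇ-suc k (#greater x α) ⟩
    k ≤ᵇ #greater x α  ∎

mmpGo-MMPmax-after-max : ∀ k {n} pre β → n ∈ pre → All (_< n) β → mmpGo (MMPmax k) pre β ≡ 0
mmpGo-MMPmax-after-max k pre []       _  _ = refl
mmpGo-MMPmax-after-max k pre (y ∷ ys) n∈ (y< ∷ ys<)
  rewrite MMPmax≡false k pre y ys (noneGreater≡false pre n∈ y<)
  = mmpGo-MMPmax-after-max k (pre ∷ʳ y) ys (∈-++⁺ˡ n∈) ys<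

mmpGo-MMPmax-++-∷ : ∀ k {n} pre α β → All (_< n) α → All (_< n) β →
  mmpGo (MMPmax (suc k)) pre (α ++ n ∷ β) ≡ mmpGo (MMP k) pre α
mmpGo-MMPmax-++-∷ k {n} pre [] β _ β<
  rewrite MMPmax-at-max k pre β β<
  = mmpGo-MMPmax-after-max (suc k) (pre ∷ʳ n) β (∈-++⁺ʳ pre (here refl)) β<
mmpGo-MMPmax-++-∷ k pre (x ∷ α) β (x< ∷ α<) β< =
  cong₂ (λ b c → (if b then 1 else 0) + c)
    (MMPmax-before-max k pre α β α< β< x<)
    (mmpGo-MMPmax-++-∷ k (pre ∷ʳ x) α β α< β<)

mmp-MMPmax-++-∷ : ∀ k {n} α β → All (_< n) α → All (_< n) β →
  mmp (MMPmax (suc k)) (α ++ n ∷ β) ≡ mmp (MMP k) α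
mmp-MMPmax-++-∷ k = mmpGo-MMPmax-++-∷ k []

punchIn : ℕ → ℕ → ℕ
punchIn zero    v       = suc v
punchIn (suc a) zero    = zero
punchIn (suc a) (suc v) = suc (punchIn a v)

punchOut : ℕ → ℕ → ℕ
punchOut zero    v       = pred v
punchOut (suc a) zero    = zero
punchOut (suc a) (suc v) = suc (punchOut a v)

punchOut-punchIn : ∀ a v → punchOut a (punchIn a v) ≡ v
punchOut-punchIn zero    v       = refl
punchOut-punchIn (suc a) zero    = refl
punchOut-punchIn (suc a) (suc v) = cong suc (punchOut-punchIn a v)

punchIn-punchOut : ∀ {a v} → v ≢ a → punchIn a (punchOut a v) ≡ v
punchIn-punchOut {zero}  {zero}  v≢a = ⊥-elim (v≢a refl)
punchIn-punchOut {zero}  {suc v} _   = refl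
punchIn-punchOut {suc a} {zero}  _   = refl
punchIn-punchOut {suc a} {suc v} v≢a = cong suc (punchIn-punchOut (v≢a ∘ cong suc))

punchIn≢ : ∀ a v → punchIn a v ≢ a
punchIn≢ zero    v       ()
punchIn≢ (suc a) zero    ()
punchIn≢ (suc a) (suc v) eq = punchIn≢ a v (cong pred eq)

punchIn-injective : ∀ a {v w} → punchIn a v ≡ punchIn a w → v ≡ w
punchIn-injective a {v} {w} eq =
  trans (sym (punchOut-punchIn a v)) (trans (cong (punchOut a) eq) (punchOut-punchIn a w))

punchIn-< : ∀ {n} a v → a ≤ n → v < n → punchIn a v < suc n
punchIn-< zero    v       _         v<n       = s≤s v<n
punchIn-< (suc a) zero    _         (s≤s _)   = s≤s z≤n
punchIn-< (suc a) (suc v) (s≤s a≤n) (s≤s v<n) = s≤s (punchIn-< a v a≤n v<n)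

punchOut-< : ∀ {n} a v → a < suc n → v < suc n → v ≢ a → punchOut a v < n
punchOut-<         zero    zero    _         _         v≢a = ⊥-elim (v≢a refl)
punchOut-<         zero    (suc v) _         (s≤s v<n) _   = v<n
punchOut-< {zero}  (suc a) v       (s≤s ())  _         _
punchOut-< {suc n} (suc a) zero    _         _         _   = s≤s z≤n
punchOut-< {suc n} (suc a) (suc v) (s≤s a<n) (s≤s v<n) v≢a = s≤s (punchOut-< a v a<n v<n (v≢a ∘ cong suc))

punchIn-≥ : ∀ {a v} → a ≤ v → punchIn a v ≡ suc v
punchIn-≥ {zero}  _         = refl
punchIn-≥ {suc a} (s≤s a≤v) = cong suc (punchIn-≥ a≤v)

punchIn-orderEmbedding : ∀ a → OrderEmbedding (punchIn a)
punchIn-orderEmbedding zero    x       y       = refl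
punchIn-orderEmbedding (suc a) zero    zero    = refl
punchIn-orderEmbedding (suc a) zero    (suc y) = refl
punchIn-orderEmbedding (suc a) (suc x) zero    = refl
punchIn-orderEmbedding (suc a) (suc x) (suc y) = punchIn-orderEmbedding a x y

record IsPermutation (n : ℕ) (σ : List ℕ) : Set where
  constructor isPermutation
  field
    length≡ : length σ ≡ n
    bounded : All (_< n) σ
    unique  : Unique σ

bounded⇒∉ : ∀ {n xs} → All (_< n) xs → n ∉ xs
bounded⇒∉ xs< n∈ = <-irrefl refl (All.lookup xs< n∈)

++-∷-isPermutation : ∀ {n} α β → IsPermutation n (α ++ β) → IsPermutation (suc n) (α ++ n ∷ β)
++-∷-isPermutation {n} α β (isPermutation len αβ< αβ-unique) with All.++⁻ α αβ<
... | α< , β< = isPermutation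
  (trans (length-++-sucʳ α n β) (cong suc len))
  (All.++⁺ (All.map m<n⇒m<1+n α<) (n<1+n n ∷ All.map m<n⇒m<1+n β<))
  (Unique-++-∷⁺ α β (bounded⇒∉ αβ<) αβ-unique)

++-∷-isPermutation⁻ : ∀ {n} α β → IsPermutation (suc n) (α ++ n ∷ β) → IsPermutation n (α ++ β)
++-∷-isPermutation⁻ {n} α β (isPermutation len σ< σ-unique)
  with All.++⁻ α σ< | Unique-++-∷⁻ α β σ-unique
... | α< , _ ∷ β< | n∉ , αβ-unique = isPermutation
  (suc-injective (trans (sym (length-++-sucʳ α n β)) len))
  (All.tabulate λ {z} z∈ →
    ≤∧≢⇒< (≤-pred (All.lookup (All.++⁺ α< β<) z∈)) λ z≡n → n∉ (subst (_∈ α ++ β) z≡n z∈))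
  αβ-unique

words-unique : ∀ n m → Unique (words n m)
words-unique n zero    = [] ∷ []
words-unique n (suc m) =
  subst Unique (sym (concatMap≡cartesianProductWith _∷ᵥ_ (allFin n) (words n m)))
    (Unique.cartesianProductWith⁺ _∷ᵥ_ Vec.∷-injective (Unique.allFin⁺ n) (words-unique n m))

∈-words : ∀ {n m} (w : Vec (Fin n) m) → w ∈ words n m
∈-words []ᵥ       = here refl
∈-words {n} {suc m} (a ∷ᵥ w) =
  subst (a ∷ᵥ w ∈_) (sym (concatMap≡cartesianProductWith _∷ᵥ_ (allFin n) (words n m)))
    (∈-cartesianProductWith⁺ _∷ᵥ_ (∈-allFin a) (∈-words w))

toℕs : ∀ {n m} → Vec (Fin n) m → List ℕ
toℕs w = map toℕ (toList w)

toℕs-injective : ∀ {n m} {v w : Vec (Fin n) m} → toℕs v ≡ toℕs w → v ≡ w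
toℕs-injective {v = []ᵥ}    {[]ᵥ}    _  = refl
toℕs-injective {v = a ∷ᵥ v} {b ∷ᵥ w} eq =
  cong₂ _∷ᵥ_ (Fin.toℕ-injective (∷-injectiveˡ eq)) (toℕs-injective (∷-injectiveʳ eq))

fromBounded : ∀ {n} σ → All (_< n) σ → Σ (Vec (Fin n) (length σ)) λ w → toℕs w ≡ σ
fromBounded []      []          = []ᵥ , refl
fromBounded (x ∷ σ) (x<n ∷ σ<n) with fromBounded σ σ<n
... | w , eq = fromℕ< x<n ∷ᵥ w , cong₂ _∷_ (Fin.toℕ-fromℕ< x<n) eq

perms-unique : ∀ n → Unique (perms n)
perms-unique n = Unique.map⁺ toℕs-injective (Unique.filter⁺ _ (words-unique n n))

∈-perms⇒IsPermutation : ∀ {n σ} → σ ∈ perms n → IsPermutation n σ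
∈-perms⇒IsPermutation {n} σ∈ with ∈-map⁻ toℕs σ∈
... | w , w∈ , refl with ∈-filter⁻ (λ w → UniqueDec.unique? (Fin._≟_ {n}) (toList w)) {xs = words n n} w∈
... | _ , w-unique = isPermutation (length-toℕs w) (toℕs-bounded w) (Unique.map⁺ Fin.toℕ-injective w-unique)
  where
  length-toℕs : ∀ {m} (v : Vec (Fin n) m) → length (toℕs v) ≡ m
  length-toℕs []ᵥ       = refl
  length-toℕs (_ ∷ᵥ v) = cong suc (length-toℕs v)
  toℕs-bounded : ∀ {m} (v : Vec (Fin n) m) → All (_< n) (toℕs v)
  toℕs-bounded []ᵥ       = []
  toℕs-bounded (a ∷ᵥ v) = Fin.toℕ<n a ∷ toℕs-bounded v

IsPermutation⇒∈-perms : ∀ {n σ} → IsPermutation n σ → σ ∈ perms n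
IsPermutation⇒∈-perms {σ = σ} (isPermutation refl σ< σ-unique) with fromBounded σ σ<
... | w , toℕs-w≡σ = subst (_∈ perms (length σ)) toℕs-w≡σ
  (∈-map⁺ toℕs (∈-filter⁺ (λ w → UniqueDec.unique? (Fin._≟_ {length σ}) (toList w)) (∈-words w)
                          (Unique.map⁻ (subst Unique (sym toℕs-w≡σ) σ-unique))))

perms-↭ : ∀ {n} {L : List (List ℕ)} → Unique L →
  (∀ {σ} → σ ∈ L → IsPermutation n σ) → (∀ {σ} → IsPermutation n σ → σ ∈ L) → perms n ↭ L
perms-↭ {n} L-unique sound complete = ∼bag⇒↭ (unique∧set⇒bag (perms-unique n) L-unique
  (mk⇔ (complete ∘ ∈-perms⇒IsPermutation) (IsPermutation⇒∈-perms ∘ sound)))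

-- Permutations by their last value

snocPunch : ℕ → List ℕ → List ℕ
snocPunch a τ = map (punchIn a) τ ∷ʳ a

permsBySnoc : ℕ → List (List ℕ)
permsBySnoc zero    = [ [] ]
permsBySnoc (suc n) = cartesianProductWith snocPunch (upTo (suc n)) (permsBySnoc n)

snocPunch-injective : ∀ {a a′ τ τ′} → snocPunch a τ ≡ snocPunch a′ τ′ → a ≡ a′ × τ ≡ τ′
snocPunch-injective {a} {τ = τ} eq with ∷ʳ-injective (map (punchIn a) τ) _ eq
... | map≡ , refl = refl , map-injective (punchIn-injective a) map≡

permsBySnoc-unique : ∀ n → Unique (permsBySnoc n)
permsBySnoc-unique zero    = [] ∷ []
permsBySnoc-unique (suc n) =
  Unique.cartesianProductWith⁺ snocPunch snocPunch-injective (Unique.upTo⁺ (suc n)) (permsBySnoc-unique n)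

snocPunch-isPermutation : ∀ {n a τ} → a < suc n → IsPermutation n τ → IsPermutation (suc n) (snocPunch a τ)
snocPunch-isPermutation {a = a} {τ} a< (isPermutation refl τ< τ-unique) = isPermutation
  (trans (length-∷ʳ (map (punchIn a) τ) a) (cong suc (length-map (punchIn a) τ)))
  (All.∷ʳ⁺ (All.map⁺ (All.map (λ {v} → punchIn-< a v (≤-pred a<)) τ<)) a<)
  (Unique.++⁺ (Unique.map⁺ (punchIn-injective a) τ-unique) ([] ∷ []) a∉)
  where
  a∉ : ∀ {v} → v ∈ map (punchIn a) τ × v ∈ [ a ] → ⊥
  a∉ (v∈ , here refl) with ∈-map⁻ (punchIn a) v∈
  ... | w , _ , eq = punchIn≢ a w (sym eq)

∈-permsBySnoc⇒IsPermutation : ∀ {n σ} → σ ∈ permsBySnoc n → IsPermutation n σ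
∈-permsBySnoc⇒IsPermutation {zero}  (here refl) = isPermutation refl [] []
∈-permsBySnoc⇒IsPermutation {suc n} σ∈
  with ∈-cartesianProductWith⁻ snocPunch (upTo (suc n)) (permsBySnoc n) σ∈
... | a , τ , a∈ , τ∈ , refl = snocPunch-isPermutation (∈-upTo⁻ a∈) (∈-permsBySnoc⇒IsPermutation τ∈)

map-punchIn-punchOut : ∀ {a} σ → a ∉ σ → map (punchIn a) (map (punchOut a) σ) ≡ σ
map-punchIn-punchOut []      _  = refl
map-punchIn-punchOut (v ∷ σ) a∉ =
  cong₂ _∷_ (punchIn-punchOut (a∉ ∘ here ∘ sym)) (map-punchIn-punchOut σ (a∉ ∘ there))

IsPermutation⇒∈-permsBySnoc : ∀ {n σ} → IsPermutation n σ → σ ∈ permsBySnoc n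
IsPermutation⇒∈-permsBySnoc {zero}  {[]} _ = here refl
IsPermutation⇒∈-permsBySnoc {suc n} {σ} (isPermutation len σ< σ-unique) with initLast σ
... | σ′ ∷ʳ′ a with All.∷ʳ⁻ σ< | Unique-∷ʳ⁻ σ′ σ-unique
...   | σ′< , a< | a∉ , σ′-unique =
  subst (_∈ permsBySnoc (suc n)) (cong (_∷ʳ a) (map-punchIn-punchOut σ′ a∉))
    (∈-cartesianProductWith⁺ snocPunch (∈-upTo⁺ a<) (IsPermutation⇒∈-permsBySnoc τ-isPermutation))
  where
  v≢a : ∀ {v} → v ∈ σ′ → v ≢ a
  v≢a v∈ v≡a = a∉ (subst (_∈ σ′) v≡a v∈)
  τ-isPermutation : IsPermutation n (map (punchOut a) σ′)
  τ-isPermutation = isPermutation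
    (trans (length-map (punchOut a) σ′) (suc-injective (trans (sym (length-∷ʳ σ′ a)) len)))
    (All.map⁺ (All.tabulate λ {v} v∈ → punchOut-< a v a< (All.lookup σ′< v∈) (v≢a v∈)))
    (map-unique (λ {v} {w} v∈ w∈ eq → begin
        v                          ≡⟨ punchIn-punchOut (v≢a v∈) ⟨
        punchIn a (punchOut a v)   ≡⟨ cong (punchIn a) eq ⟩
        punchIn a (punchOut a w)   ≡⟨ punchIn-punchOut (v≢a w∈) ⟩
        w                          ∎) σ′-unique)

perms↭permsBySnoc : ∀ n → perms n ↭ permsBySnoc n
perms↭permsBySnoc n = perms-↭ (permsBySnoc-unique n) ∈-permsBySnoc⇒IsPermutation IsPermutation⇒∈-permsBySnoc

∈-permsBySnoc⇒max∈ : ∀ {n σ} → σ ∈ permsBySnoc (suc n) → n ∈ σ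
∈-permsBySnoc⇒max∈ {n} σ∈
  with ∈-cartesianProductWith⁻ snocPunch (upTo (suc n)) (permsBySnoc n) σ∈
... | a , τ , a∈ , τ∈ , refl with m≤n⇒m<n∨m≡n (≤-pred (∈-upTo⁻ a∈))
...   | inj₂ refl = ∈-++⁺ʳ (map (punchIn a) τ) (here refl)
...   | inj₁ (s≤s a≤n-1) =
  ∈-++⁺ˡ (subst (_∈ map (punchIn a) τ) (punchIn-≥ a≤n-1)
                (∈-map⁺ (punchIn a) (∈-permsBySnoc⇒max∈ τ∈)))

-- Completeness of permsBySnoc stands in for a pigeonhole argument here.
IsPermutation⇒max∈ : ∀ {n σ} → IsPermutation (suc n) σ → n ∈ σ
IsPermutation⇒max∈ = ∈-permsBySnoc⇒max∈ ∘ IsPermutation⇒∈-permsBySnoc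

-- Counting by prefixes

fallingRatio-refl : ∀ i → fallingRatio i i ≡ 1
fallingRatio-refl i = n/n≡1 (i !) {{i !≢0}}

fallingRatio-suc : ∀ {N i} → i ≤ N → fallingRatio (suc N) i ≡ suc N * fallingRatio N i
fallingRatio-suc {N} {i} i≤N = *-/-assoc (suc N) {N !} {i !} {{i !≢0}} (m≤n⇒m!∣n! i≤N)

take-snocPunch : ∀ a i τ → i ≤ length τ → take i (snocPunch a τ) ≡ map (punchIn a) (take i τ)
take-snocPunch a zero    τ       _         = refl
take-snocPunch a (suc i) (v ∷ τ) (s≤s i≤) = cong (punchIn a v ∷_) (take-snocPunch a i τ i≤)

count-take-permsBySnoc-suc : ∀ {g : List ℕ → ℕ} {i N} j → OrderInvariant g → i ≤ N →
  count (g ∘ take i) j (permsBySnoc (suc N)) ≡ suc N * count (g ∘ take i) j (permsBySnoc N)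
count-take-permsBySnoc-suc {g} {i} {N} j g-inv i≤N = begin
  count (g ∘ take i) j (permsBySnoc (suc N))
    ≡⟨ count-cartesianProductWith snocPunch (upTo (suc N)) (permsBySnoc N) ⟩
  sum (map (λ a → count (g ∘ take i ∘ snocPunch a) j (permsBySnoc N)) (upTo (suc N)))
    ≡⟨ sum-map-cong (upTo (suc N)) (λ {a} _ → count-cong (punchIn-invisible a)) ⟩
  sum (map (λ _ → c) (upTo (suc N)))
    ≡⟨ sum-map-const c (upTo (suc N)) ⟩
  length (upTo (suc N)) * c
    ≡⟨ cong (_* c) (length-upTo (suc N)) ⟩
  suc N * c  ∎
  where
  c : ℕ
  c = count (g ∘ take i) j (permsBySnoc N)
  punchIn-invisible : ∀ a {τ} → τ ∈ permsBySnoc N → g (take i (snocPunch a τ)) ≡ g (take i τ)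
  punchIn-invisible a {τ} τ∈ = begin
    g (take i (snocPunch a τ))      ≡⟨ cong g (take-snocPunch a i τ i≤τ) ⟩
    g (map (punchIn a) (take i τ))  ≡⟨ g-inv (punchIn a) (punchIn-orderEmbedding a) (take i τ) ⟩
    g (take i τ)                    ∎
    where
    i≤τ : i ≤ length τ
    i≤τ = subst (i ≤_) (sym (IsPermutation.length≡ (∈-permsBySnoc⇒IsPermutation τ∈))) i≤N

count-take-permsBySnoc : ∀ {g : List ℕ → ℕ} {i N} j → OrderInvariant g → i ≤′ N →
  count (g ∘ take i) j (permsBySnoc N) ≡ fallingRatio N i * count g j (permsBySnoc i)
count-take-permsBySnoc {g} {i} j _ ≤′-refl = begin
  count (g ∘ take i) j (permsBySnoc i)          ≡⟨ count-cong (cong g ∘ take-whole) ⟩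
  count g j (permsBySnoc i)                     ≡⟨ *-identityˡ _ ⟨
  1 * count g j (permsBySnoc i)                 ≡⟨ cong (_* count g j (permsBySnoc i)) (fallingRatio-refl i) ⟨
  fallingRatio i i * count g j (permsBySnoc i)  ∎
  where
  take-whole : ∀ {τ} → τ ∈ permsBySnoc i → take i τ ≡ τ
  take-whole {τ} τ∈ =
    take-all i τ (≤-reflexive (IsPermutation.length≡ (∈-permsBySnoc⇒IsPermutation τ∈)))
count-take-permsBySnoc {g} {i} {suc N} j g-inv (≤′-step i≤′N) = begin
  count (g ∘ take i) j (permsBySnoc (suc N))      ≡⟨ count-take-permsBySnoc-suc j g-inv (≤′⇒≤ i≤′N) ⟩
  suc N * count (g ∘ take i) j (permsBySnoc N)    ≡⟨ cong (suc N *_) (count-take-permsBySnoc j g-inv i≤′N) ⟩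
  suc N * (fallingRatio N i * c)                  ≡⟨ *-assoc (suc N) (fallingRatio N i) c ⟨
  suc N * fallingRatio N i * c                    ≡⟨ cong (_* c) (fallingRatio-suc (≤′⇒≤ i≤′N)) ⟨
  fallingRatio (suc N) i * c                      ∎
  where
  c : ℕ
  c = count g j (permsBySnoc i)

-- Inserting the maximum

insertAt : ℕ → ℕ → List ℕ → List ℕ
insertAt i x τ = take i τ ++ x ∷ drop i τ

permsByMax : ℕ → List (List ℕ)
permsByMax n = cartesianProductWith (λ i → insertAt i n) (upTo (suc n)) (permsBySnoc n)

insertAt-injective : ∀ {x i i′ τ τ′} → i ≤ length τ → i′ ≤ length τ′ →
  All (_< x) τ → All (_< x) τ′ → insertAt i x τ ≡ insertAt i′ x τ′ → i ≡ i′ × τ ≡ τ′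
insertAt-injective {i = i} {i′} {τ} {τ′} i≤ i′≤ τ< τ′< eq
  with ++-∷-injective (bounded⇒∉ (All.take⁺ i τ<)) (bounded⇒∉ (All.take⁺ i′ τ′<)) eq
... | take≡ , drop≡ =
  trans (sym (length-take-≤ τ i≤)) (trans (cong length take≡) (length-take-≤ τ′ i′≤)) ,
  (begin
    τ                            ≡⟨ take++drop≡id i τ ⟨
    take i τ ++ drop i τ         ≡⟨ cong₂ _++_ take≡ drop≡ ⟩
    take i′ τ′ ++ drop i′ τ′     ≡⟨ take++drop≡id i′ τ′ ⟩
    τ′                           ∎)

permsByMax-unique : ∀ n → Unique (permsByMax n)
permsByMax-unique n =
  cartesianProductWith-unique (λ i → insertAt i n) injective (Unique.upTo⁺ (suc n)) (permsBySnoc-unique n)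
  where
  injective : ∀ {i i′ τ τ′} → i ∈ upTo (suc n) → i′ ∈ upTo (suc n) →
    τ ∈ permsBySnoc n → τ′ ∈ permsBySnoc n → insertAt i n τ ≡ insertAt i′ n τ′ → i ≡ i′ × τ ≡ τ′
  injective {τ = τ} {τ′} i∈ i′∈ τ∈ τ′∈
    with ∈-permsBySnoc⇒IsPermutation {n} τ∈ | ∈-permsBySnoc⇒IsPermutation {n} τ′∈
  ... | isPermutation len τ< _ | isPermutation len′ τ′< _ =
    insertAt-injective (bound τ len i∈) (bound τ′ len′ i′∈) τ< τ′<
    where
    bound : ∀ {i} τ → length τ ≡ n → i ∈ upTo (suc n) → i ≤ length τ
    bound τ len i∈ = subst (_ ≤_) (sym len) (≤-pred (∈-upTo⁻ i∈))

∈-permsByMax⇒IsPermutation : ∀ {n σ} → σ ∈ permsByMax n → IsPermutation (suc n) σ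
∈-permsByMax⇒IsPermutation {n} σ∈
  with ∈-cartesianProductWith⁻ (λ i → insertAt i n) (upTo (suc n)) (permsBySnoc n) σ∈
... | i , τ , _ , τ∈ , refl = ++-∷-isPermutation (take i τ) (drop i τ)
  (subst (IsPermutation n) (sym (take++drop≡id i τ)) (∈-permsBySnoc⇒IsPermutation τ∈))

IsPermutation⇒∈-permsByMax : ∀ {n σ} → IsPermutation (suc n) σ → σ ∈ permsByMax n
IsPermutation⇒∈-permsByMax {n} σ-perm with ∈-∃++ (IsPermutation⇒max∈ σ-perm)
... | α , β , refl =
  subst (_∈ permsByMax n) (cong₂ (λ γ δ → γ ++ n ∷ δ) (take-length-++ α β) (drop-length-++ α β))
    (∈-cartesianProductWith⁺ (λ i → insertAt i n) (∈-upTo⁺ (s≤s α≤n))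
                             (IsPermutation⇒∈-permsBySnoc αβ-perm))
  where
  αβ-perm : IsPermutation n (α ++ β)
  αβ-perm = ++-∷-isPermutation⁻ α β σ-perm
  α≤n : length α ≤ n
  α≤n = subst (length α ≤_) (IsPermutation.length≡ αβ-perm) (length-++-≤ˡ α)

perms↭permsByMax : ∀ n → perms (suc n) ↭ permsByMax n
perms↭permsByMax n = perms-↭ (permsByMax-unique n) ∈-permsByMax⇒IsPermutation IsPermutation⇒∈-permsByMax

count-insertAt-max : ∀ k {n i} j → i ≤ n →
  count (mmp (MMPmax (suc k)) ∘ insertAt i n) j (permsBySnoc n) ≡ fallingRatio n i * coeff (MMP k) i j
count-insertAt-max k {n} {i} j i≤n = begin
  count (mmp (MMPmax (suc k)) ∘ insertAt i n) j (permsBySnoc n)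
    ≡⟨ count-cong split ⟩
  count (mmp (MMP k) ∘ take i) j (permsBySnoc n)
    ≡⟨ count-take-permsBySnoc j (mmp-MMP-orderInvariant k) (≤⇒≤′ i≤n) ⟩
  fallingRatio n i * count (mmp (MMP k)) j (permsBySnoc i)
    ≡⟨ cong (fallingRatio n i *_) (count-↭ (perms↭permsBySnoc i)) ⟨
  fallingRatio n i * coeff (MMP k) i j  ∎
  where
  split : ∀ {τ} → τ ∈ permsBySnoc n → mmp (MMPmax (suc k)) (insertAt i n τ) ≡ mmp (MMP k) (take i τ)
  split {τ} τ∈ = mmp-MMPmax-++-∷ k (take i τ) (drop i τ) (All.take⁺ i τ<) (All.drop⁺ i τ<)
    where
    τ< : All (_< n) τ
    τ< = IsPermutation.bounded (∈-permsBySnoc⇒IsPermutation τ∈)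

-- The identity holds for every k ≥ 1; the hypothesis 2 ≤ k only excludes k = 0.
mainTheorem9 : (k : ℕ) → 2 ≤ k → (n j : ℕ) →
    coeff (MMPmax k) (suc n) j
    ≡ sum (map (λ i → fallingRatio n i * coeff (MMP (k ∸ 1)) i j) (upTo (suc n)))
mainTheorem9 (suc k) _ n j = begin
  coeff (MMPmax (suc k)) (suc n) j
    ≡⟨ count-↭ (perms↭permsByMax n) ⟩
  count (mmp (MMPmax (suc k))) j (permsByMax n)
    ≡⟨ count-cartesianProductWith (λ i → insertAt i n) (upTo (suc n)) (permsBySnoc n) ⟩
  sum (map (λ i → count (mmp (MMPmax (suc k)) ∘ insertAt i n) j (permsBySnoc n)) (upTo (suc n)))
    ≡⟨ sum-map-cong (upTo (suc n)) (λ i∈ → count-insertAt-max k j (≤-pred (∈-upTo⁻ i∈))) ⟩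
  sum (map (λ i → fallingRatio n i * coeff (MMP k) i j) (upTo (suc n)))  ∎
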